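{- Let $n,\ell,u$ be integers with $n\ge \ell+u$ (and $\ell,u\ge 0$). Fix $L\subseteq\{0,\dots,\ell-1\}$ and $U\subseteq\{n-u,\dots,n-1\}$. Let $R$ be a uniformly randomly chosen subset of $\{\ell,\dots,n-u-1\}$ and set $A:=L\cup R\cup U$. Then for any integer $k$ with $n+\ell-1\le k\le 2n-2u-1$, \[ \Pr(k\notin A+A)=\begin{cases}(1/2)^{|U|}(3/4)^{n-(k+1)/2-u}, & k \text{ odd},\\ (1/2)^{|U|+1}(3/4)^{n-1-k/2-u}, & k\text{ even}.\end{cases} \]
   Context: $A+A=\{a_1+a_2: a_1,a_2\in A\}$. "Uniformly randomly chosen subset" means each of the $2^{n-\ell-u}$ subsets is chosen with equal probability. -}

module Defs where

open import Data.Bool using (Bool; true; false; _∧_; not; if_then_else_)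
open import Data.Nat using (ℕ; zero; suc; _+_; _∸_; _^_; _<ᵇ_)
open import Data.Nat.Properties using (m^n≢0)
open import Data.Fin using (Fin; fromℕ<)
open import Data.Fin.Subset using (Subset)
open import Data.Vec using (Vec; []; _∷_; lookup)
open import Data.List using (List; []; _∷_; map; _++_; length; filter; upTo)
open import Data.Bool.ListAction using (any)
open import Data.Integer using (+_)
open import Data.Rational using (ℚ; 1ℚ; _*_; _/_)
open import Relation.Binary.PropositionalEquality using (_≡_)
open import Relation.Nullary.Decidable using (yes; no)
open import Data.Nat using (_<_; _<?_)
open import Data.Bool using (T)
open import Data.Bool.Properties using (T?)

_^ℚ_ : ℚ → ℕ → ℚ
q ^ℚ zero = 1ℚ
q ^ℚ suc e = q * (q ^ℚ e)

allSubsets : (m : ℕ) → List (Subset m)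
allSubsets zero = [] ∷ []
allSubsets (suc m) = map (true ∷_) (allSubsets m) ++ map (false ∷_) (allSubsets m)

memShift : ∀ {m} → ℕ → Subset m → ℕ → Bool
memShift {m} off S x with x <? off
... | yes _ = false
... | no _ with (x ∸ off) <? m
...   | yes p = lookup S (fromℕ< p)
...   | no _ = false

-- Characteristic function of A = L ∪ R ∪ U, where
--   L ⊆ {0,…,ℓ-1}        is given as a Subset ℓ (index i ↦ i),
--   R ⊆ {ℓ,…,n-u-1}      is given as a Subset (n-ℓ-u) (index i ↦ ℓ+i),
--   U ⊆ {n-u,…,n-1}      is given as a Subset u (index i ↦ n-u+i).
memA : (n ℓ u : ℕ) → Subset ℓ → Subset (n ∸ ℓ ∸ u) → Subset u → ℕ → Bool
memA n ℓ u L R U x =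
  if memShift 0 L x then true else
  if memShift ℓ R x then true else
  memShift (n ∸ u) U x

-- k ∈ A + A  iff  there is a₁ ∈ {0,…,k} with a₁ ∈ A and k - a₁ ∈ A
-- (A ⊆ ℕ, so any decomposition k = a₁ + a₂ has a₁ ≤ k and a₂ = k - a₁).
memSumset : (ℕ → Bool) → ℕ → Bool
memSumset A k = any (λ a → A a ∧ A (k ∸ a)) (upTo (suc k))

countMissing : (n ℓ u : ℕ) → Subset ℓ → Subset u → ℕ → ℕ
countMissing n ℓ u L U k =
  length (filter (λ R → T? (not (memSumset (memA n ℓ u L R U) k))) (allSubsets (n ∸ ℓ ∸ u)))

probMissing : (n ℓ u : ℕ) → Subset ℓ → Subset u → ℕ → ℚ
probMissing n ℓ u L U k =
  _/_ (+ countMissing n ℓ u L U k) (2 ^ (n ∸ ℓ ∸ u)) {{m^n≢0 2 (n ∸ ℓ ∸ u)}}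

-- Write k + 1 = n + ℓ + w.  If a + b = k and a < ℓ + w then b ≥ n, so only the window [ℓ + w, n)
-- of A matters, and k ∉ A + A says that no two positions of this window that are mirror images
-- about its centre (a position may be its own image) both lie in A.  The window consists of u bits
-- of R, N further bits of R and the u bits of U; the bound k < 2n - 2u is exactly N ≥ 0.  So the
-- outer u pairs match bits w, …, w + u - 1 of R with U read backwards, and the N inner bits form
-- ⌊N/2⌋ pairs and, for odd N, one centre.  These constraints concern disjoint bits of the uniformly
-- random R, hence are independent: each element of U contributes a factor 1/2, each inner pair 3/4
-- and the centre 1/2.  As k + 1 ≡ N (mod 2), N is odd exactly when k is even.
module Submission where

open import Defs
open import Algebra.Bundles using (CommutativeMonoid)
open import Data.Bool using (Bool; true; false; _∧_; _∨_; not; if_then_else_; T)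
open import Data.Bool.ListAction using (any)
open import Data.Bool.Properties
  using (T?; ∧-assoc; ∧-comm; ∧-idem; ∧-identityʳ; ∧-zeroʳ; ∧-conicalˡ; ∧-conicalʳ; ∧-commutativeMonoid;
         ∨-conicalˡ; ∨-conicalʳ; ∨-identityʳ; not-injective)
open import Data.Fin using (fromℕ<)
open import Data.Fin.Subset using (Subset; ∣_∣)
open import Data.Integer using (+_)
open import Data.Integer.Properties using (pos-*)
open import Data.List using ([]; _∷_; _++_; map; filter; length; upTo)
open import Data.List.Membership.Propositional using (_∈_)
open import Data.List.Membership.Propositional.Properties using (∈-upTo⁺; ∈-upTo⁻)
open import Data.List.Properties using (filter-++; filter-≐; length-++)
open import Data.List.Relation.Unary.Any using (here; there)
open import Data.Nat
open import Data.Nat.DivMod using (m≡m%n+[m/n]*n; m%n<n; m*n/n≡m; m*n%n≡0; %-distribˡ-+)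
open import Data.Nat.Properties
open import Data.Nat.Tactic.RingSolver using (solve-∀)
open import Data.Product using (_×_; _,_; proj₁; proj₂)
open import Data.Rational using (½)
import Data.Rational as Q
open import Data.Rational.Properties using (fromℚᵘ-cong; toℚᵘ-fromℚᵘ; toℚᵘ-homo-*; toℚᵘ-injective)
open import Data.Rational.Unnormalised.Base using (mkℚᵘ; *≡*)
open import Data.Rational.Unnormalised.Properties using (≃-reflexive; ≃-sym; ≃-trans) renaming (*-cong to *ᵘ-cong)
open import Data.Vec using ([]; _∷_; lookup)
open import Function using (_∘_)
open import Function.Definitions using (Injective)
open import Relation.Binary.PropositionalEquality
open import Relation.Nullary using (yes; no; contradiction)

open import Algebra.Properties.CommutativeSemigroup +-commutativeSemigroup
  using () renaming (interchange to +-interchange)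
open import Algebra.Properties.CommutativeSemigroup *-commutativeSemigroup
  using () renaming (xy∙z≈y∙xz to *-xy∙z≈y∙xz)
open import Algebra.Properties.CommutativeSemigroup (CommutativeMonoid.commutativeSemigroup ∧-commutativeMonoid)
  using () renaming (x∙yz≈y∙xz to ∧-swapˡ)
open ≡-Reasoning

-- Counting subsets by their bits

bit : ∀ {m} → Subset m → ℕ → Bool
bit []      _       = false
bit (b ∷ S) zero    = b
bit (b ∷ S) (suc i) = bit S i

setBit : ∀ {m} → Subset m → ℕ → Bool → Subset m
setBit []      _       _ = []
setBit (_ ∷ S) zero    b = b ∷ S
setBit (c ∷ S) (suc i) b = c ∷ setBit S i b

bit-≥ : ∀ {m} (S : Subset m) {i} → m ≤ i → bit S i ≡ false
bit-≥ []      _         = refl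
bit-≥ (b ∷ S) (s≤s m≤i) = bit-≥ S m≤i

bit-setBit-≡ : ∀ {m} (S : Subset m) {x} b → x < m → bit (setBit S x b) x ≡ b
bit-setBit-≡ (c ∷ S) {zero}  b _         = refl
bit-setBit-≡ (c ∷ S) {suc x} b (s≤s x<m) = bit-setBit-≡ S b x<m

bit-setBit-≢ : ∀ {m} (S : Subset m) {x y} b → x ≢ y → bit (setBit S x b) y ≡ bit S y
bit-setBit-≢ []      {_}     {_}     b x≢y = refl
bit-setBit-≢ (c ∷ S) {zero}  {zero}  b x≢y = contradiction refl x≢y
bit-setBit-≢ (c ∷ S) {zero}  {suc y} b x≢y = refl
bit-setBit-≢ (c ∷ S) {suc x} {zero}  b x≢y = refl
bit-setBit-≢ (c ∷ S) {suc x} {suc y} b x≢y = bit-setBit-≢ S b (x≢y ∘ cong suc)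

count : (m : ℕ) → (Subset m → Bool) → ℕ
count m Q = length (filter (λ S → T? (Q S)) (allSubsets m))

length-filter-map : ∀ {A B : Set} (p : B → Bool) (g : A → B) xs →
  length (filter (λ y → T? (p y)) (map g xs)) ≡ length (filter (λ x → T? (p (g x))) xs)
length-filter-map p g []       = refl
length-filter-map p g (x ∷ xs) with p (g x)
... | true  = cong suc (length-filter-map p g xs)
... | false = length-filter-map p g xs

count-∷ : ∀ m Q → count (suc m) Q ≡ count m (λ S → Q (true ∷ S)) + count m (λ S → Q (false ∷ S))
count-∷ m Q = begin
  length (filter Q? (withTrue ++ withFalse))                  ≡⟨ cong length (filter-++ Q? withTrue withFalse) ⟩
  length (filter Q? withTrue ++ filter Q? withFalse)           ≡⟨ length-++ (filter Q? withTrue) ⟩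
  length (filter Q? withTrue) + length (filter Q? withFalse)   ≡⟨ cong₂ _+_ (length-filter-map Q (true ∷_) all)
                                                                                (length-filter-map Q (false ∷_) all) ⟩
  count m (λ S → Q (true ∷ S)) + count m (λ S → Q (false ∷ S)) ∎
  where
  Q? = λ S → T? (Q S)
  all = allSubsets m
  withTrue  = map (true ∷_) all
  withFalse = map (false ∷_) all

count-cong : ∀ {m} {P Q : Subset m → Bool} → (∀ S → P S ≡ Q S) → count m P ≡ count m Q
count-cong {m} {P} {Q} P≗Q = cong length (filter-≐ (λ S → T? (P S)) (λ S → T? (Q S)) P≐Q (allSubsets m))
  where P≐Q = (λ {S} → subst T (P≗Q S)) , (λ {S} → subst T (sym (P≗Q S)))

count-true : ∀ m → count m (λ _ → true) ≡ 2 ^ m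
count-true zero    = refl
count-true (suc m) =
  trans (count-∷ m _) (cong₂ _+_ (count-true m) (trans (count-true m) (sym (+-identityʳ (2 ^ m)))))

count-false : ∀ m → count m (λ _ → false) ≡ 0
count-false zero    = refl
count-false (suc m) = trans (count-∷ m _) (cong₂ _+_ (count-false m) (count-false m))

count-condition : ∀ {m x} → x < m → ∀ Q →
  2 * count m Q ≡ count m (λ S → Q (setBit S x true)) + count m (λ S → Q (setBit S x false))
count-condition {suc m} {zero} _ Q = begin
  2 * count (suc m) Q ≡⟨ cong (2 *_) (count-∷ m Q) ⟩
  2 * (t + f)         ≡⟨ double-sum t f ⟩
  (t + t) + (f + f)   ≡⟨ cong₂ _+_ (count-∷ m _) (count-∷ m _) ⟨
  count (suc m) (λ S → Q (setBit S 0 true)) + count (suc m) (λ S → Q (setBit S 0 false)) ∎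
  where
  t = count m (λ S → Q (true ∷ S))
  f = count m (λ S → Q (false ∷ S))
  double-sum : ∀ a b → 2 * (a + b) ≡ (a + a) + (b + b)
  double-sum = solve-∀
count-condition {suc m} {suc x} (s≤s x<m) Q = begin
  2 * count (suc m) Q   ≡⟨ cong (2 *_) (count-∷ m Q) ⟩
  2 * (t + f)           ≡⟨ *-distribˡ-+ 2 t f ⟩
  2 * t + 2 * f         ≡⟨ cong₂ _+_ (count-condition x<m _) (count-condition x<m _) ⟩
  (tt + tf) + (ft + ff) ≡⟨ +-interchange tt tf ft ff ⟩
  (tt + ft) + (tf + ff) ≡⟨ cong₂ _+_ (count-∷ m _) (count-∷ m _) ⟨
  count (suc m) (λ S → Q (setBit S (suc x) true)) + count (suc m) (λ S → Q (setBit S (suc x) false)) ∎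
  where
  t  = count m (λ S → Q (true ∷ S))
  f  = count m (λ S → Q (false ∷ S))
  tt = count m (λ S → Q (true ∷ setBit S x true))
  tf = count m (λ S → Q (true ∷ setBit S x false))
  ft = count m (λ S → Q (false ∷ setBit S x true))
  ff = count m (λ S → Q (false ∷ setBit S x false))

IgnoresBit : ∀ {m} → ℕ → (Subset m → Bool) → Set
IgnoresBit x Q = ∀ S b → Q (setBit S x b) ≡ Q S

ignoresBit-∧ : ∀ {m x} {P Q : Subset m → Bool} →
  IgnoresBit x P → IgnoresBit x Q → IgnoresBit x (λ S → P S ∧ Q S)
ignoresBit-∧ P-ign Q-ign S b = cong₂ _∧_ (P-ign S b) (Q-ign S b)

count-by-bit : ∀ {m x} → x < m → (F : Bool → Subset m → Bool) → (∀ b → IgnoresBit x (F b)) →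
  2 * count m (λ S → F (bit S x) S) ≡ count m (F true) + count m (F false)
count-by-bit {x = x} x<m F F-ign =
  trans (count-condition x<m _) (cong₂ _+_ (count-cong (fixed true)) (count-cong (fixed false)))
  where
  fixed : ∀ b S → F (bit (setBit S x b) x) (setBit S x b) ≡ F b S
  fixed b S = trans (cong (λ c → F c (setBit S x b)) (bit-setBit-≡ S b x<m)) (F-ign b S b)

count-avoid : ∀ {m x} {Q : Subset m → Bool} → x < m → IgnoresBit x Q →
  2 * count m (λ S → not (bit S x) ∧ Q S) ≡ count m Q
count-avoid {m} {Q = Q} x<m Q-ign =
  trans (count-by-bit x<m (λ b S → not b ∧ Q S) (λ b S c → cong (not b ∧_) (Q-ign S c)))
        (cong (_+ count m Q) (count-false m))

count-avoid-pair : ∀ {m x y} {Q : Subset m → Bool} → x < m → y < m → x ≢ y →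
  IgnoresBit x Q → IgnoresBit y Q →
  4 * count m (λ S → not (bit S x ∧ bit S y) ∧ Q S) ≡ 3 * count m Q
count-avoid-pair {m} {x} {y} {Q} x<m y<m x≢y Q-ignx Q-igny = begin
  4 * count m (λ S → F (bit S x) S)        ≡⟨ *-assoc 2 2 (count m (λ S → F (bit S x) S)) ⟩
  2 * (2 * count m (λ S → F (bit S x) S))  ≡⟨ cong (2 *_) (count-by-bit x<m F F-ign) ⟩
  2 * (count m (F true) + count m Q)       ≡⟨ *-distribˡ-+ 2 (count m (F true)) (count m Q) ⟩
  2 * count m (F true) + 2 * count m Q     ≡⟨ cong (_+ 2 * count m Q) (count-avoid y<m Q-igny) ⟩
  3 * count m Q                            ∎
  where
  F : Bool → Subset m → Bool
  F b S = not (b ∧ bit S y) ∧ Q S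
  F-ign : ∀ b → IgnoresBit x (F b)
  F-ign b S c = cong₂ (λ v q → not (b ∧ v) ∧ q) (bit-setBit-≢ S c x≢y) (Q-ignx S c)

-- Mirror-free and antidiagonal-free bit sequences

mirrorFree : (ℕ → Bool) → ℕ → Bool
mirrorFree Z zero          = true
mirrorFree Z (suc zero)    = not (Z 0)
mirrorFree Z (suc (suc N)) = not (Z 0 ∧ Z (suc N)) ∧ mirrorFree (λ i → Z (suc i)) N

NoMirrorPair : (ℕ → Bool) → ℕ → Set
NoMirrorPair Z N = ∀ i j → suc (i + j) ≡ N → Z i ∧ Z j ≡ false

mirrorFree⁻ : ∀ {Z} N → mirrorFree Z N ≡ true → NoMirrorPair Z N
mirrorFree⁻ (suc zero)    h zero    zero    refl = trans (∧-idem _) (not-injective h)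
mirrorFree⁻ (suc (suc N)) h zero    _       refl = not-injective (∧-conicalˡ _ _ h)
mirrorFree⁻ {Z} (suc (suc N)) h (suc i) zero e =
  trans (∧-comm (Z (suc i)) (Z 0)) (subst (λ t → Z 0 ∧ Z (suc t) ≡ false) (sym i≡N) outer)
  where
  outer = not-injective (∧-conicalˡ _ _ h)
  i≡N = trans (sym (+-identityʳ i)) (suc-injective (suc-injective e))
mirrorFree⁻ (suc (suc N)) h (suc i) (suc j) e =
  mirrorFree⁻ N (∧-conicalʳ _ _ h) i j (trans (sym (+-suc i j)) (suc-injective (suc-injective e)))

mirrorFree⁺ : ∀ {Z} N → NoMirrorPair Z N → mirrorFree Z N ≡ true
mirrorFree⁺     zero          _ = refl
mirrorFree⁺ {Z} (suc zero)    h = cong not (trans (sym (∧-idem (Z 0))) (h 0 0 refl))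
mirrorFree⁺     (suc (suc N)) h =
  cong₂ _∧_ (cong not (h 0 (suc N) refl))
            (mirrorFree⁺ N (λ i j e → h (suc i) (suc j) (cong (suc ∘ suc) (trans (+-suc i j) e))))

mirrorFree-cong : ∀ {Z Z′} N → (∀ i → i < N → Z i ≡ Z′ i) → mirrorFree Z N ≡ mirrorFree Z′ N
mirrorFree-cong zero          _  = refl
mirrorFree-cong (suc zero)    Z≡ = cong not (Z≡ 0 z<s)
mirrorFree-cong (suc (suc N)) Z≡ =
  cong₂ _∧_ (cong not (cong₂ _∧_ (Z≡ 0 z<s) (Z≡ (suc N) (n<1+n (suc N)))))
            (mirrorFree-cong N (λ i i<N → Z≡ (suc i) (s<s (m<n⇒m<1+n i<N))))

antidiagFree : (ℕ → Bool) → (ℕ → Bool) → ℕ → Bool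
antidiagFree X Y zero    = true
antidiagFree X Y (suc f) = not (X 0 ∧ Y f) ∧ antidiagFree (λ i → X (suc i)) Y f

antidiagFree-last : ∀ X Y f →
  antidiagFree X Y (suc f) ≡ not (X f ∧ Y 0) ∧ antidiagFree X (λ j → Y (suc j)) f
antidiagFree-last X Y zero    = refl
antidiagFree-last X Y (suc f) = begin
  first ∧ antidiagFree (λ i → X (suc i)) Y (suc f)
    ≡⟨ cong (first ∧_) (antidiagFree-last (λ i → X (suc i)) Y f) ⟩
  first ∧ (last ∧ inner)
    ≡⟨ ∧-swapˡ first last inner ⟩
  last ∧ (first ∧ inner)
    ∎
  where
  first = not (X 0 ∧ Y (suc f))
  last  = not (X (suc f) ∧ Y 0)
  inner = antidiagFree (λ i → X (suc i)) (λ j → Y (suc j)) f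

antidiagFree-cong : ∀ {X X′ Y Y′} f → (∀ i → i < f → X i ≡ X′ i) → (∀ j → j < f → Y j ≡ Y′ j) →
  antidiagFree X Y f ≡ antidiagFree X′ Y′ f
antidiagFree-cong zero    _  _  = refl
antidiagFree-cong (suc f) X≡ Y≡ =
  cong₂ _∧_ (cong not (cong₂ _∧_ (X≡ 0 z<s) (Y≡ f (n<1+n f))))
            (antidiagFree-cong f (λ i i<f → X≡ (suc i) (s<s i<f)) (λ j j<f → Y≡ j (m<n⇒m<1+n j<f)))

mirrorFree-split : ∀ Z u N →
  mirrorFree Z (u + N + u) ≡ antidiagFree (λ y → Z (u + N + y)) Z u ∧ mirrorFree (λ i → Z (u + i)) N
mirrorFree-split Z zero    N = cong (mirrorFree Z) (+-identityʳ N)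
mirrorFree-split Z (suc u) N = begin
  mirrorFree Z (suc u + N + suc u)
    ≡⟨ cong (mirrorFree Z ∘ suc) (+-suc (u + N) u) ⟩
  not (Z 0 ∧ Z last) ∧ mirrorFree (λ i → Z (suc i)) (u + N + u)
    ≡⟨ cong (not (Z 0 ∧ Z last) ∧_) (mirrorFree-split (λ i → Z (suc i)) u N) ⟩
  not (Z 0 ∧ Z last) ∧ (inner ∧ rest)
    ≡⟨ ∧-assoc (not (Z 0 ∧ Z last)) inner rest ⟨
  (not (Z 0 ∧ Z last) ∧ inner) ∧ rest
    ≡⟨ cong (λ b → (not b ∧ inner) ∧ rest) (∧-comm (Z 0) (Z last)) ⟩
  (not (Z last ∧ Z 0) ∧ inner) ∧ rest
    ≡⟨ cong (_∧ rest) (antidiagFree-last (λ y → Z (suc u + N + y)) Z u) ⟨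
  antidiagFree (λ y → Z (suc u + N + y)) Z (suc u) ∧ rest
    ∎
  where
  last  = suc (u + N + u)
  inner = antidiagFree (λ y → Z (suc u + N + y)) (λ i → Z (suc i)) u
  rest  = mirrorFree (λ i → Z (suc u + i)) N

antidiagFree-ignores : ∀ {m x} X {β : ℕ → ℕ} f → (∀ j → j < f → x ≢ β j) →
  IgnoresBit {m} x (λ S → antidiagFree X (bit S ∘ β) f)
antidiagFree-ignores X f x∉β S b =
  antidiagFree-cong f (λ _ _ → refl) (λ j j<f → bit-setBit-≢ S b (x∉β j j<f))

mirrorFree-ignores : ∀ {m x} {α : ℕ → ℕ} N → (∀ i → i < N → x ≢ α i) →
  IgnoresBit {m} x (λ S → mirrorFree (bit S ∘ α) N)
mirrorFree-ignores N x∉α S b = mirrorFree-cong N (λ i i<N → bit-setBit-≢ S b (x∉α i i<N))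

count-antidiagFree : ∀ {m u} (U : Subset u) {β : ℕ → ℕ} {Q : Subset m → Bool} → Injective _≡_ _≡_ β →
  (∀ i → i < u → β i < m) → (∀ i → i < u → IgnoresBit (β i) Q) →
  2 ^ ∣ U ∣ * count m (λ S → antidiagFree (bit U) (bit S ∘ β) u ∧ Q S) ≡ count m Q
count-antidiagFree []          _     _  _     = +-identityʳ _
count-antidiagFree (false ∷ U) β-inj β< Q-ign =
  count-antidiagFree U β-inj (λ i → β< i ∘ m<n⇒m<1+n) (λ i → Q-ign i ∘ m<n⇒m<1+n)
count-antidiagFree {m} {suc u} (true ∷ U) {β} {Q} β-inj β< Q-ign = begin
  2 ^ suc ∣ U ∣ * count m (λ S → (not (bit S (β u)) ∧ A S) ∧ Q S)
    ≡⟨ cong (2 ^ suc ∣ U ∣ *_) (count-cong (λ S → ∧-assoc (not (bit S (β u))) (A S) (Q S))) ⟩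
  2 * 2 ^ ∣ U ∣ * count m (λ S → not (bit S (β u)) ∧ (A S ∧ Q S))
    ≡⟨ *-xy∙z≈y∙xz 2 (2 ^ ∣ U ∣) _ ⟩
  2 ^ ∣ U ∣ * (2 * count m (λ S → not (bit S (β u)) ∧ (A S ∧ Q S)))
    ≡⟨ cong (2 ^ ∣ U ∣ *_) (count-avoid (β< u (n<1+n u)) A∧Q-ign) ⟩
  2 ^ ∣ U ∣ * count m (λ S → A S ∧ Q S)
    ≡⟨ count-antidiagFree U β-inj (λ i → β< i ∘ m<n⇒m<1+n) (λ i → Q-ign i ∘ m<n⇒m<1+n) ⟩
  count m Q
    ∎
  where
  A : Subset m → Bool
  A S = antidiagFree (bit U) (bit S ∘ β) u
  A∧Q-ign : IgnoresBit (β u) (λ S → A S ∧ Q S)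
  A∧Q-ign = ignoresBit-∧ (antidiagFree-ignores (bit U) u (λ j j<u e → <⇒≢ j<u (sym (β-inj e)))) (Q-ign u (n<1+n u))

count-mirrorFree-centre : ∀ {m c} {α : ℕ → ℕ} {Q : Subset m → Bool} → c ≤ 1 →
  (∀ i → i < c → α i < m) → (∀ i → i < c → IgnoresBit (α i) Q) →
  2 ^ c * count m (λ S → mirrorFree (bit S ∘ α) c ∧ Q S) ≡ count m Q
count-mirrorFree-centre z≤n       _  _     = +-identityʳ _
count-mirrorFree-centre (s≤s z≤n) α< Q-ign = count-avoid (α< 0 z<s) (Q-ign 0 z<s)

count-mirrorFree-step : ∀ {m L} {α : ℕ → ℕ} {Q : Subset m → Bool} → Injective _≡_ _≡_ α →
  α 0 < m → α (suc L) < m → IgnoresBit (α 0) Q → IgnoresBit (α (suc L)) Q →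
  4 * count m (λ S → mirrorFree (bit S ∘ α) (suc (suc L)) ∧ Q S) ≡
  3 * count m (λ S → mirrorFree (bit S ∘ α ∘ suc) L ∧ Q S)
count-mirrorFree-step {m} {L} {α} {Q} α-inj α₀<m αₗ<m Q-ign₀ Q-ignₗ =
  trans (cong (4 *_) (count-cong (λ S → ∧-assoc _ (inner S) (Q S))))
        (count-avoid-pair α₀<m αₗ<m (0≢1+n ∘ α-inj)
          (ignoresBit-∧ (mirrorFree-ignores L (λ i _ e → 0≢1+n (α-inj e))) Q-ign₀)
          (ignoresBit-∧ (mirrorFree-ignores L (λ i i<L e → <⇒≢ i<L (sym (suc-injective (α-inj e))))) Q-ignₗ))
  where
  inner : Subset m → Bool
  inner S = mirrorFree (bit S ∘ α ∘ suc) L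

count-mirrorFree : ∀ {m} p {c} {α : ℕ → ℕ} {Q : Subset m → Bool} → c ≤ 1 → Injective _≡_ _≡_ α →
  (∀ i → i < p * 2 + c → α i < m) → (∀ i → i < p * 2 + c → IgnoresBit (α i) Q) →
  4 ^ p * (2 ^ c * count m (λ S → mirrorFree (bit S ∘ α) (p * 2 + c) ∧ Q S)) ≡ 3 ^ p * count m Q
count-mirrorFree zero    c≤1 _     α< Q-ign = cong (1 *_) (count-mirrorFree-centre c≤1 α< Q-ign)
count-mirrorFree {m} (suc p) {c} {α} {Q} c≤1 α-inj α< Q-ign = begin
  4 ^ suc p * (2 ^ c * outer)        ≡⟨ *-assoc 4 (4 ^ p) (2 ^ c * outer) ⟩
  4 * (4 ^ p * (2 ^ c * outer))      ≡⟨ pull-left 4 (4 ^ p) (2 ^ c) outer ⟨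
  4 ^ p * (2 ^ c * (4 * outer))      ≡⟨ cong (λ t → 4 ^ p * (2 ^ c * t)) step ⟩
  4 ^ p * (2 ^ c * (3 * inner))      ≡⟨ pull-left 3 (4 ^ p) (2 ^ c) inner ⟩
  3 * (4 ^ p * (2 ^ c * inner))      ≡⟨ cong (3 *_) (count-mirrorFree p c≤1 (suc-injective ∘ α-inj)
                                                       (λ i → α< (suc i) ∘ inward) (λ i → Q-ign (suc i) ∘ inward)) ⟩
  3 * (3 ^ p * count m Q)            ≡⟨ *-assoc 3 (3 ^ p) (count m Q) ⟨
  3 ^ suc p * count m Q              ∎
  where
  pull-left : ∀ k a b c → a * (b * (k * c)) ≡ k * (a * (b * c))
  pull-left = solve-∀
  L = p * 2 + c
  outer = count m (λ S → mirrorFree (bit S ∘ α) (suc (suc L)) ∧ Q S)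
  inner = count m (λ S → mirrorFree (bit S ∘ α ∘ suc) L ∧ Q S)
  inward : ∀ {i} → i < L → suc i < suc (suc L)
  inward i<L = s<s (m<n⇒m<1+n i<L)
  step = count-mirrorFree-step α-inj (α< 0 z<s) (α< (suc L) (n<1+n (suc L))) (Q-ign 0 z<s) (Q-ign (suc L) (n<1+n (suc L)))

-- Sumsets and the set A = L ∪ R ∪ U

any-≡false⁻ : ∀ {A : Set} (p : A → Bool) {xs x} → any p xs ≡ false → x ∈ xs → p x ≡ false
any-≡false⁻ p {y ∷ ys} h (here refl) = ∨-conicalˡ (p y) (any p ys) h
any-≡false⁻ p {y ∷ ys} h (there x∈) = any-≡false⁻ p (∨-conicalʳ (p y) (any p ys) h) x∈

any-≡false⁺ : ∀ {A : Set} (p : A → Bool) xs → (∀ {x} → x ∈ xs → p x ≡ false) → any p xs ≡ false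
any-≡false⁺ p []       _ = refl
any-≡false⁺ p (x ∷ xs) h = cong₂ _∨_ (h (here refl)) (any-≡false⁺ p xs (h ∘ there))

AvoidsSum : (ℕ → Bool) → ℕ → Set
AvoidsSum A k = ∀ a b → a + b ≡ k → A a ∧ A b ≡ false

memSumset⁻ : ∀ A {k} → memSumset A k ≡ false → AvoidsSum A k
memSumset⁻ A h a b refl =
  subst (λ c → A a ∧ A c ≡ false) (m+n∸m≡n a b) (any-≡false⁻ _ h (∈-upTo⁺ (s≤s (m≤m+n a b))))

memSumset⁺ : ∀ A {k} → AvoidsSum A k → memSumset A k ≡ false
memSumset⁺ A {k} h =
  any-≡false⁺ _ (upTo (suc k)) (λ {a} a∈ → h a (k ∸ a) (m+[n∸m]≡n (s≤s⁻¹ (∈-upTo⁻ a∈))))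

data Offset (s : ℕ) : ℕ → Set where
  below : ∀ {a} → a < s → Offset s a
  above : ∀ i → Offset s (s + i)

offset : ∀ s a → Offset s a
offset s a with a <? s
... | yes a<s = below a<s
... | no  a≮s = subst (Offset s) (m+[n∸m]≡n (≮⇒≥ a≮s)) (above (a ∸ s))

≡false⇔≡true⇒not≡ : ∀ {x y} → (x ≡ false → y ≡ true) → (y ≡ true → x ≡ false) → not x ≡ y
≡false⇔≡true⇒not≡ {false}         to _    = sym (to refl)
≡false⇔≡true⇒not≡ {true}  {false} _  _    = refl
≡false⇔≡true⇒not≡ {true}  {true}  _  from = sym (from refl)

not-memSumset≡mirrorFree : ∀ A {s T k} → (∀ v → s + T ≤ v → A v ≡ false) → suc k ≡ s + T + s →
  not (memSumset A k) ≡ mirrorFree (λ j → A (s + j)) T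
not-memSumset≡mirrorFree A {s} {T} {k} vanish k≡ =
  ≡false⇔≡true⇒not≡ (mirrorFree⁺ T ∘ inside ∘ memSumset⁻ A) (memSumset⁺ A ∘ outside ∘ mirrorFree⁻ T)
  where
  pair-sum : ∀ s i j → suc (s + i + (s + j)) ≡ s + suc (i + j) + s
  pair-sum = solve-∀

  inside : AvoidsSum A k → NoMirrorPair (λ j → A (s + j)) T
  inside h i j e = h (s + i) (s + j) (suc-injective (begin
    suc (s + i + (s + j)) ≡⟨ pair-sum s i j ⟩
    s + suc (i + j) + s   ≡⟨ cong (λ t → s + t + s) e ⟩
    s + T + s             ≡⟨ k≡ ⟨
    suc k                 ∎))

  beyond : ∀ {a b} → a < s → a + b ≡ k → s + T ≤ b
  beyond {a} {b} a<s e = +-cancelʳ-≤ s (s + T) b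
    (≤-trans (≤-reflexive (sym (trans (cong suc e) k≡)))
      (≤-trans (+-monoˡ-≤ b a<s) (≤-reflexive (+-comm s b))))

  outside : NoMirrorPair (λ j → A (s + j)) T → AvoidsSum A k
  outside h a b e with offset s a | offset s b
  ... | below a<s | _         = trans (cong (A a ∧_) (vanish b (beyond a<s e))) (∧-zeroʳ (A a))
  ... | above i   | below b<s = cong (_∧ A b) (vanish (s + i) (beyond b<s (trans (+-comm b (s + i)) e)))
  ... | above i   | above j   = h i j (+-cancelˡ-≡ s _ _ (+-cancelʳ-≡ s _ _ (begin
    s + suc (i + j) + s   ≡⟨ pair-sum s i j ⟨
    suc (s + i + (s + j)) ≡⟨ cong suc e ⟩
    suc k                 ≡⟨ k≡ ⟩
    s + T + s             ∎)))

lookup-fromℕ< : ∀ {m} (S : Subset m) {i} (i<m : i < m) → lookup S (fromℕ< i<m) ≡ bit S i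
lookup-fromℕ< (b ∷ S) {zero}  _         = refl
lookup-fromℕ< (b ∷ S) {suc i} (s≤s i<m) = lookup-fromℕ< S i<m

memShift-< : ∀ {m} off (S : Subset m) {x} → x < off → memShift off S x ≡ false
memShift-< off S {x} x<off with x <? off
... | yes _    = refl
... | no x≮off = contradiction x<off x≮off

memShift-+ : ∀ {m} off (S : Subset m) i → memShift off S (off + i) ≡ bit S i
memShift-+ {m} off S i with off + i <? off
... | yes off+i<off = contradiction off+i<off (m+n≮m off i)
... | no _ with off + i ∸ off <? m
...   | yes i<m = trans (lookup-fromℕ< S i<m) (cong (bit S) (m+n∸m≡n off i))
...   | no i≮m  = sym (bit-≥ S (subst (m ≤_) (m+n∸m≡n off i) (≮⇒≥ i≮m)))

memShift-≥ : ∀ {m} off (S : Subset m) {x} → off + m ≤ x → memShift off S x ≡ false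
memShift-≥ {m} off S {x} off+m≤x = begin
  memShift off S x                 ≡⟨ cong (memShift off S) (m+[n∸m]≡n off≤x) ⟨
  memShift off S (off + (x ∸ off)) ≡⟨ memShift-+ off S (x ∸ off) ⟩
  bit S (x ∸ off)                  ≡⟨ bit-≥ S m≤x∸off ⟩
  false                            ∎
  where
  off≤x = ≤-trans (m≤m+n off m) off+m≤x
  m≤x∸off = subst (_≤ x ∸ off) (m+n∸m≡n off m) (∸-monoˡ-≤ off off+m≤x)

if-∨ : ∀ a b → (if a then true else b) ≡ a ∨ b
if-∨ true  _ = refl
if-∨ false _ = refl

memA-∨ : ∀ n ℓ u L R U x →
  memA n ℓ u L R U x ≡ memShift 0 L x ∨ memShift ℓ R x ∨ memShift (n ∸ u) U x
memA-∨ n ℓ u L R U x =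
  trans (if-∨ (memShift 0 L x) _) (cong (memShift 0 L x ∨_) (if-∨ (memShift ℓ R x) _))

ℓ+[n∸ℓ∸u]≡n∸u : ∀ n ℓ u → ℓ + u ≤ n → ℓ + (n ∸ ℓ ∸ u) ≡ n ∸ u
ℓ+[n∸ℓ∸u]≡n∸u n ℓ u ℓ+u≤n = begin
  ℓ + (n ∸ ℓ ∸ u) ≡⟨ +-∸-assoc ℓ u≤n∸ℓ ⟨
  ℓ + (n ∸ ℓ) ∸ u ≡⟨ cong (_∸ u) (m+[n∸m]≡n (≤-trans (m≤m+n ℓ u) ℓ+u≤n)) ⟩
  n ∸ u           ∎
  where u≤n∸ℓ = subst (_≤ n ∸ ℓ) (m+n∸m≡n ℓ u) (∸-monoˡ-≤ ℓ ℓ+u≤n)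

ℓ+[n∸ℓ∸u]+u≡n : ∀ n ℓ u → ℓ + u ≤ n → ℓ + (n ∸ ℓ ∸ u) + u ≡ n
ℓ+[n∸ℓ∸u]+u≡n n ℓ u ℓ+u≤n =
  trans (cong (_+ u) (ℓ+[n∸ℓ∸u]≡n∸u n ℓ u ℓ+u≤n)) (m∸n+n≡m (≤-trans (m≤n+m u ℓ) ℓ+u≤n))

module _ {n ℓ u} (ℓ+u≤n : ℓ + u ≤ n) (L : Subset ℓ) (R : Subset (n ∸ ℓ ∸ u)) (U : Subset u) where

  private
    ℓ+M≡n∸u : ℓ + (n ∸ ℓ ∸ u) ≡ n ∸ u
    ℓ+M≡n∸u = ℓ+[n∸ℓ∸u]≡n∸u n ℓ u ℓ+u≤n

  memA-window : ∀ {i} → i < n ∸ ℓ ∸ u → memA n ℓ u L R U (ℓ + i) ≡ bit R i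
  memA-window {i} i<M = begin
    memA n ℓ u L R U (ℓ + i)
      ≡⟨ memA-∨ n ℓ u L R U (ℓ + i) ⟩
    memShift 0 L (ℓ + i) ∨ memShift ℓ R (ℓ + i) ∨ memShift (n ∸ u) U (ℓ + i)
      ≡⟨ cong₂ _∨_ (memShift-≥ 0 L (m≤m+n ℓ i))
                   (cong₂ _∨_ (memShift-+ ℓ R i) (memShift-< (n ∸ u) U ℓ+i<n∸u)) ⟩
    bit R i ∨ false
      ≡⟨ ∨-identityʳ (bit R i) ⟩
    bit R i
      ∎
    where ℓ+i<n∸u = subst (ℓ + i <_) ℓ+M≡n∸u (+-monoʳ-< ℓ i<M)

  memA-upper : ∀ y → memA n ℓ u L R U (n ∸ u + y) ≡ bit U y
  memA-upper y = begin
    memA n ℓ u L R U (n ∸ u + y)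
      ≡⟨ memA-∨ n ℓ u L R U (n ∸ u + y) ⟩
    memShift 0 L (n ∸ u + y) ∨ memShift ℓ R (n ∸ u + y) ∨ memShift (n ∸ u) U (n ∸ u + y)
      ≡⟨ cong₂ _∨_ (memShift-≥ 0 L (≤-trans (m≤m+n ℓ _) ℓ+M≤))
                   (cong₂ _∨_ (memShift-≥ ℓ R ℓ+M≤) (memShift-+ (n ∸ u) U y)) ⟩
    bit U y
      ∎
    where ℓ+M≤ = ≤-trans (≤-reflexive ℓ+M≡n∸u) (m≤m+n (n ∸ u) y)

  memA-≥ : ∀ {v} → n ≤ v → memA n ℓ u L R U v ≡ false
  memA-≥ {v} n≤v = begin
    memA n ℓ u L R U v
      ≡⟨ memA-∨ n ℓ u L R U v ⟩
    memShift 0 L v ∨ memShift ℓ R v ∨ memShift (n ∸ u) U v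
      ≡⟨ cong₂ _∨_ (memShift-≥ 0 L (≤-trans (m≤m+n ℓ _) ℓ+M≤v))
                   (cong₂ _∨_ (memShift-≥ ℓ R ℓ+M≤v) (memShift-≥ (n ∸ u) U n∸u+u≤v)) ⟩
    false
      ∎
    where
    ℓ+M≤v = ≤-trans (≤-reflexive ℓ+M≡n∸u) (≤-trans (m∸n≤m n u) n≤v)
    n∸u+u≤v = subst (_≤ v) (sym (m∸n+n≡m (≤-trans (m≤n+m u ℓ) ℓ+u≤n))) n≤v

-- The subsets R with k ∉ A + A

missingPattern : ∀ {m u} → Subset u → ℕ → ℕ → Subset m → Bool
missingPattern {u = u} U w N R =
  antidiagFree (bit U) (λ j → bit R (w + j)) u ∧ mirrorFree (λ i → bit R (w + u + i)) N

count-missingPattern : ∀ {m u} (U : Subset u) w p {c} → c ≤ 1 → w + u + (p * 2 + c) ≤ m →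
  2 ^ (∣ U ∣ + c) * (4 ^ p * count m (missingPattern U w (p * 2 + c))) ≡ 3 ^ p * 2 ^ m
count-missingPattern {m} {u} U w p {c} c≤1 fits = begin
  2 ^ (∣ U ∣ + c) * (4 ^ p * count m (missingPattern U w N))
    ≡⟨ cong (_* (4 ^ p * count m (missingPattern U w N))) (^-distribˡ-+-* 2 ∣ U ∣ c) ⟩
  2 ^ ∣ U ∣ * 2 ^ c * (4 ^ p * count m (missingPattern U w N))
    ≡⟨ regroup (2 ^ ∣ U ∣) (2 ^ c) (4 ^ p) _ ⟩
  4 ^ p * (2 ^ c * (2 ^ ∣ U ∣ * count m (missingPattern U w N)))
    ≡⟨ cong (λ t → 4 ^ p * (2 ^ c * t)) (count-antidiagFree U (+-cancelˡ-≡ w _ _) lower< lower-ignored) ⟩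
  4 ^ p * (2 ^ c * count m centre)
    ≡⟨ cong (λ t → 4 ^ p * (2 ^ c * t)) (count-cong (λ S → sym (∧-identityʳ (centre S)))) ⟩
  4 ^ p * (2 ^ c * count m (λ S → centre S ∧ true))
    ≡⟨ count-mirrorFree p c≤1 (+-cancelˡ-≡ (w + u) _ _) centre< (λ _ _ _ _ → refl) ⟩
  3 ^ p * count m (λ _ → true)
    ≡⟨ cong (3 ^ p *_) (count-true m) ⟩
  3 ^ p * 2 ^ m
    ∎
  where
  N = p * 2 + c
  centre : Subset m → Bool
  centre S = mirrorFree (λ i → bit S (w + u + i)) N
  regroup : ∀ a b d x → a * b * (d * x) ≡ d * (b * (a * x))
  regroup = solve-∀
  lower< : ∀ i → i < u → w + i < m
  lower< i i<u = ≤-trans (+-monoʳ-< w i<u) (≤-trans (m≤m+n (w + u) N) fits)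
  centre< : ∀ i → i < N → w + u + i < m
  centre< i i<N = ≤-trans (+-monoʳ-< (w + u) i<N) fits
  lower-ignored : ∀ i → i < u → IgnoresBit (w + i) centre
  lower-ignored i i<u = mirrorFree-ignores N λ j _ e →
    <⇒≱ i<u (subst (u ≤_) (sym (+-cancelˡ-≡ w i (u + j) (trans e (+-assoc w u j)))) (m≤m+n u j))

not-memSumset≡missingPattern : ∀ {n ℓ u k w N} →
  ℓ + u ≤ n → n + ℓ + w ≡ k + 1 → w + u + N ≡ n ∸ ℓ ∸ u →
  (L : Subset ℓ) (U : Subset u) (R : Subset (n ∸ ℓ ∸ u)) →
  not (memSumset (memA n ℓ u L R U) k) ≡ missingPattern U w N R
not-memSumset≡missingPattern {n} {ℓ} {u} {k} {w} {N} ℓ+u≤n k≡ M≡ L U R = begin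
  not (memSumset A k)
    ≡⟨ not-memSumset≡mirrorFree A {ℓ + w} {u + N + u} vanish sk≡ ⟩
  mirrorFree (λ j → A (ℓ + w + j)) (u + N + u)
    ≡⟨ mirrorFree-split (λ j → A (ℓ + w + j)) u N ⟩
  antidiagFree (λ y → A (ℓ + w + (u + N + y))) (λ j → A (ℓ + w + j)) u ∧
  mirrorFree (λ i → A (ℓ + w + (u + i))) N
    ≡⟨ cong₂ _∧_ (antidiagFree-cong u upper lower) (mirrorFree-cong N centre) ⟩
  missingPattern U w N R
    ∎
  where
  window-layout : ∀ ℓ w u N y → ℓ + w + (u + N + y) ≡ ℓ + (w + u + N) + y
  window-layout = solve-∀
  window-shift : ∀ ℓ w u i → ℓ + w + (u + i) ≡ ℓ + (w + u + i)
  window-shift = solve-∀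
  A = memA n ℓ u L R U
  n∸u≡ : n ∸ u ≡ ℓ + (w + u + N)
  n∸u≡ = trans (sym (ℓ+[n∸ℓ∸u]≡n∸u n ℓ u ℓ+u≤n)) (cong (λ t → ℓ + t) (sym M≡))
  n≡ : n ≡ ℓ + w + (u + N + u)
  n≡ = begin
    n                     ≡⟨ ℓ+[n∸ℓ∸u]+u≡n n ℓ u ℓ+u≤n ⟨
    ℓ + (n ∸ ℓ ∸ u) + u   ≡⟨ cong (λ t → ℓ + t + u) M≡ ⟨
    ℓ + (w + u + N) + u   ≡⟨ window-layout ℓ w u N u ⟨
    ℓ + w + (u + N + u)   ∎
  sk≡ : suc k ≡ ℓ + w + (u + N + u) + (ℓ + w)
  sk≡ = begin
    suc k                           ≡⟨ +-comm k 1 ⟨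
    k + 1                           ≡⟨ k≡ ⟨
    n + ℓ + w                       ≡⟨ +-assoc n ℓ w ⟩
    n + (ℓ + w)                     ≡⟨ cong (_+ (ℓ + w)) n≡ ⟩
    ℓ + w + (u + N + u) + (ℓ + w)   ∎
  vanish : ∀ v → ℓ + w + (u + N + u) ≤ v → A v ≡ false
  vanish v le = memA-≥ ℓ+u≤n L R U (subst (_≤ v) (sym n≡) le)
  upper : ∀ y → y < u → A (ℓ + w + (u + N + y)) ≡ bit U y
  upper y _ = trans (cong A (trans (window-layout ℓ w u N y) (cong (_+ y) (sym n∸u≡))))
                    (memA-upper ℓ+u≤n L R U y)
  lower : ∀ j → j < u → A (ℓ + w + j) ≡ bit R (w + j)
  lower j j<u = trans (cong A (+-assoc ℓ w j))
    (memA-window ℓ+u≤n L R U (subst (w + j <_) M≡ (≤-trans (+-monoʳ-< w j<u) (m≤m+n (w + u) N))))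
  centre : ∀ i → i < N → A (ℓ + w + (u + i)) ≡ bit R (w + u + i)
  centre i i<N = trans (cong A (window-shift ℓ w u i))
    (memA-window ℓ+u≤n L R U (subst (w + u + i <_) M≡ (+-monoʳ-< (w + u) i<N)))

countMissing-≡ : ∀ {n ℓ u k} w p {c} →
  ℓ + u ≤ n → n + ℓ + w ≡ k + 1 → w + u + (p * 2 + c) ≡ n ∸ ℓ ∸ u → c ≤ 1 → (L : Subset ℓ) (U : Subset u) →
  2 ^ (∣ U ∣ + c) * (4 ^ p * countMissing n ℓ u L U k) ≡ 3 ^ p * 2 ^ (n ∸ ℓ ∸ u)
countMissing-≡ w p {c} ℓ+u≤n k≡ M≡ c≤1 L U = trans
  (cong (λ t → 2 ^ (∣ U ∣ + c) * (4 ^ p * t)) (count-cong (not-memSumset≡missingPattern ℓ+u≤n k≡ M≡ L U)))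
  (count-missingPattern U w p c≤1 (≤-reflexive M≡))

-- From counts to probabilities

/-cross : ∀ a b c d .{{_ : NonZero b}} .{{_ : NonZero d}} → a * d ≡ c * b → + a Q./ b ≡ + c Q./ d
/-cross a (suc b) c (suc d) ad≡cb = fromℚᵘ-cong {mkℚᵘ (+ a) b} {mkℚᵘ (+ c) d}
  (*≡* (trans (sym (pos-* a (suc d))) (trans (cong +_ ad≡cb) (pos-* c (suc b)))))

/-* : ∀ a b c d .{{_ : NonZero b}} .{{_ : NonZero d}} →
  (+ a Q./ b) Q.* (+ c Q./ d) ≡ (+ (a * c) Q./ (b * d)) {{m*n≢0 b d}}
/-* a (suc b) c (suc d) = toℚᵘ-injective
  (≃-trans (toℚᵘ-homo-* (+ a Q./ suc b) (+ c Q./ suc d))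
  (≃-trans (*ᵘ-cong (toℚᵘ-fromℚᵘ (mkℚᵘ (+ a) b)) (toℚᵘ-fromℚᵘ (mkℚᵘ (+ c) d)))
  (≃-trans (≃-reflexive (cong (λ z → mkℚᵘ z _) (sym (pos-* a c))))
           (≃-sym (toℚᵘ-fromℚᵘ (mkℚᵘ (+ (a * c)) _))))))

/-^ : ∀ a b .{{_ : NonZero b}} n → (+ a Q./ b) ^ℚ n ≡ (+ (a ^ n) Q./ (b ^ n)) {{m^n≢0 b n}}
/-^ a b          zero    = refl
/-^ a b {{b≢0}} (suc n) =
  trans (cong ((+ a Q./ b) Q.*_) (/-^ a b n)) (/-* a b (a ^ n) (b ^ n) {{b≢0}} {{m^n≢0 b n}})

probability-≡ : ∀ C m a p → 2 ^ a * (4 ^ p * C) ≡ 3 ^ p * 2 ^ m →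
  (+ C Q./ 2 ^ m) {{m^n≢0 2 m}} ≡ (½ ^ℚ a) Q.* ((+ 3 Q./ 4) ^ℚ p)
probability-≡ C m a p counted = sym (begin
  (½ ^ℚ a) Q.* ((+ 3 Q./ 4) ^ℚ p)
    ≡⟨ cong₂ Q._*_ (/-^ 1 2 a) (/-^ 3 4 p) ⟩
  (+ (1 ^ a) Q./ 2 ^ a) {{2^a≢0}} Q.* (+ (3 ^ p) Q./ 4 ^ p) {{4^p≢0}}
    ≡⟨ /-* (1 ^ a) (2 ^ a) (3 ^ p) (4 ^ p) {{2^a≢0}} {{4^p≢0}} ⟩
  (+ (1 ^ a * 3 ^ p) Q./ (2 ^ a * 4 ^ p)) {{m*n≢0 (2 ^ a) (4 ^ p) {{2^a≢0}} {{4^p≢0}}}}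
    ≡⟨ /-cross (1 ^ a * 3 ^ p) (2 ^ a * 4 ^ p) C (2 ^ m) {{m*n≢0 (2 ^ a) (4 ^ p) {{2^a≢0}} {{4^p≢0}}}} {{2^m≢0}} cross ⟩
  (+ C Q./ 2 ^ m) {{2^m≢0}}
    ∎)
  where
  2^a≢0 = m^n≢0 2 a
  4^p≢0 = m^n≢0 4 p
  2^m≢0 = m^n≢0 2 m
  rearrange : ∀ x y z → x * (y * z) ≡ z * (x * y)
  rearrange = solve-∀
  cross : 1 ^ a * 3 ^ p * 2 ^ m ≡ C * (2 ^ a * 4 ^ p)
  cross = begin
    1 ^ a * 3 ^ p * 2 ^ m    ≡⟨ cong (λ t → t * 3 ^ p * 2 ^ m) (^-zeroˡ a) ⟩
    1 * 3 ^ p * 2 ^ m        ≡⟨ cong (_* 2 ^ m) (*-identityˡ (3 ^ p)) ⟩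
    3 ^ p * 2 ^ m            ≡⟨ counted ⟨
    2 ^ a * (4 ^ p * C)      ≡⟨ rearrange (2 ^ a) (4 ^ p) C ⟩
    C * (2 ^ a * 4 ^ p)      ∎

-- k + 1 = n + ℓ + w, and the bits of R split into w free ones, u facing U, and a centre of
-- p * 2 + c bits.
record Window (n ℓ u k : ℕ) : Set where
  constructor window
  field
    w p c : ℕ
    c≤1   : c ≤ 1
    k+1≡  : n + ℓ + w ≡ k + 1
    M≡    : w + u + (p * 2 + c) ≡ n ∸ ℓ ∸ u

find-window : ∀ {n ℓ u k} → ℓ + u ≤ n → n + ℓ ≤ k + 1 → k + 1 ≤ 2 * n ∸ 2 * u → Window n ℓ u k
find-window {n} {ℓ} {u} {k} ℓ+u≤n lo hi with m≤n⇒∃[o]m+o≡n lo | m≤n⇒∃[o]m+o≡n hi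
... | w , k+1≡ | N , top≡ = window w (N / 2) (N % 2) (s≤s⁻¹ (m%n<n N 2)) k+1≡
  (trans (cong (λ t → w + u + t) N≡) (+-cancelˡ-≡ (ℓ + M + ℓ) _ _ twice))
  where
  M = n ∸ ℓ ∸ u
  N≡ : N / 2 * 2 + N % 2 ≡ N
  N≡ = trans (+-comm (N / 2 * 2) (N % 2)) (sym (m≡m%n+[m/n]*n N 2))
  twice : ℓ + M + ℓ + (w + u + N) ≡ ℓ + M + ℓ + M
  twice = begin
    ℓ + M + ℓ + (w + u + N)  ≡⟨ lhs ℓ M u w N ⟩
    ℓ + M + u + ℓ + w + N    ≡⟨ cong (λ t → t + ℓ + w + N) (ℓ+[n∸ℓ∸u]+u≡n n ℓ u ℓ+u≤n) ⟩
    n + ℓ + w + N            ≡⟨ cong (_+ N) k+1≡ ⟩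
    k + 1 + N                ≡⟨ top≡ ⟩
    2 * n ∸ 2 * u            ≡⟨ *-distribˡ-∸ 2 n u ⟨
    2 * (n ∸ u)              ≡⟨ cong (2 *_) (ℓ+[n∸ℓ∸u]≡n∸u n ℓ u ℓ+u≤n) ⟨
    2 * (ℓ + M)              ≡⟨ rhs ℓ M ⟩
    ℓ + M + ℓ + M            ∎
    where
    lhs : ∀ ℓ M u w N → ℓ + M + ℓ + (w + u + N) ≡ ℓ + M + u + ℓ + w + N
    lhs = solve-∀
    rhs : ∀ ℓ M → 2 * (ℓ + M) ≡ ℓ + M + ℓ + M
    rhs = solve-∀

probMissing-≡ : ∀ {n ℓ u k} → ℓ + u ≤ n → (W : Window n ℓ u k) → (L : Subset ℓ) (U : Subset u) →
  probMissing n ℓ u L U k ≡ (½ ^ℚ (∣ U ∣ + Window.c W)) Q.* ((+ 3 Q./ 4) ^ℚ Window.p W)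
probMissing-≡ {n} {ℓ} {u} ℓ+u≤n (window w p c c≤1 k+1≡ M≡) L U =
  probability-≡ _ (n ∸ ℓ ∸ u) (∣ U ∣ + c) p (countMissing-≡ w p ℓ+u≤n k+1≡ M≡ c≤1 L U)

window-halves : ∀ {n ℓ u k} → ℓ + u ≤ n → (W : Window n ℓ u k) → let open Window W in
  k + 1 ≡ c + (ℓ + u + w + p) * 2 × n ≡ ℓ + u + w + p + (u + p) + c
window-halves {n} {ℓ} {u} {k} ℓ+u≤n (window w p c _ k+1≡ M≡) =
  trans (sym k+1≡) (trans (cong (λ t → t + ℓ + w) n≡) (sum-halves ℓ u w p c)) ,
  trans n≡ (size-halves ℓ u w p c)
  where
  n≡ : n ≡ ℓ + (w + u + (p * 2 + c)) + u
  n≡ = trans (sym (ℓ+[n∸ℓ∸u]+u≡n n ℓ u ℓ+u≤n)) (cong (λ t → ℓ + t + u) (sym M≡))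
  sum-halves : ∀ ℓ u w p c → ℓ + (w + u + (p * 2 + c)) + u + ℓ + w ≡ c + (ℓ + u + w + p) * 2
  sum-halves = solve-∀
  size-halves : ∀ ℓ u w p c → ℓ + (w + u + (p * 2 + c)) + u ≡ ℓ + u + w + p + (u + p) + c
  size-halves = solve-∀

∸-∸-cancel : ∀ h u {n p} → n ≡ h + (u + p) → n ∸ h ∸ u ≡ p
∸-∸-cancel h u {p = p} refl = trans (cong (_∸ u) (m+n∸m≡n h (u + p))) (m+n∸m≡n u p)

probMissing-odd : ∀ {n ℓ u k} → ℓ + u ≤ n → Window n ℓ u k → (L : Subset ℓ) (U : Subset u) → k % 2 ≡ 1 →
  probMissing n ℓ u L U k ≡ (½ ^ℚ ∣ U ∣) Q.* ((+ 3 Q./ 4) ^ℚ (n ∸ (k + 1) / 2 ∸ u))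
probMissing-odd {n} {ℓ} {u} {k} ℓ+u≤n W@(window w p .0 z≤n _ _) L U _ = begin
  probMissing n ℓ u L U k
    ≡⟨ probMissing-≡ ℓ+u≤n W L U ⟩
  (½ ^ℚ (∣ U ∣ + 0)) Q.* ((+ 3 Q./ 4) ^ℚ p)
    ≡⟨ cong (λ a → (½ ^ℚ a) Q.* ((+ 3 Q./ 4) ^ℚ p)) (+-identityʳ ∣ U ∣) ⟩
  (½ ^ℚ ∣ U ∣) Q.* ((+ 3 Q./ 4) ^ℚ p)
    ≡⟨ cong (λ e → (½ ^ℚ ∣ U ∣) Q.* ((+ 3 Q./ 4) ^ℚ e)) exponent ⟨
  (½ ^ℚ ∣ U ∣) Q.* ((+ 3 Q./ 4) ^ℚ (n ∸ (k + 1) / 2 ∸ u))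
    ∎
  where
  h = ℓ + u + w + p
  exponent : n ∸ (k + 1) / 2 ∸ u ≡ p
  exponent = trans (cong (λ t → n ∸ t ∸ u) (trans (cong (_/ 2) (proj₁ (window-halves ℓ+u≤n W)))
                                                  (m*n/n≡m h 2)))
                   (∸-∸-cancel h u (trans (proj₂ (window-halves ℓ+u≤n W)) (+-identityʳ (h + (u + p)))))
probMissing-odd {ℓ = ℓ} {u} {k} ℓ+u≤n W@(window w p .1 (s≤s z≤n) _ _) L U k-odd =
  contradiction (trans (sym k-odd) (trans (cong (_% 2) k≡) (m*n%n≡0 (ℓ + u + w + p) 2))) λ ()
  where k≡ = suc-injective (trans (+-comm 1 k) (proj₁ (window-halves ℓ+u≤n W)))

probMissing-even : ∀ {n ℓ u k} → ℓ + u ≤ n → Window n ℓ u k → (L : Subset ℓ) (U : Subset u) → k % 2 ≡ 0 →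
  probMissing n ℓ u L U k ≡ (½ ^ℚ (∣ U ∣ + 1)) Q.* ((+ 3 Q./ 4) ^ℚ (n ∸ 1 ∸ k / 2 ∸ u))
probMissing-even {ℓ = ℓ} {u} {k} ℓ+u≤n W@(window w p .0 z≤n _ _) L U k-even =
  contradiction (trans (sym k+1-odd) (trans (cong (_% 2) (proj₁ (window-halves ℓ+u≤n W))) (m*n%n≡0 (ℓ + u + w + p) 2))) λ ()
  where k+1-odd = trans (%-distribˡ-+ k 1 2) (cong (λ r → (r + 1) % 2) k-even)
probMissing-even {n} {ℓ} {u} {k} ℓ+u≤n W@(window w p .1 (s≤s z≤n) _ _) L U _ = begin
  probMissing n ℓ u L U k
    ≡⟨ probMissing-≡ ℓ+u≤n W L U ⟩
  (½ ^ℚ (∣ U ∣ + 1)) Q.* ((+ 3 Q./ 4) ^ℚ p)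
    ≡⟨ cong (λ e → (½ ^ℚ (∣ U ∣ + 1)) Q.* ((+ 3 Q./ 4) ^ℚ e)) exponent ⟨
  (½ ^ℚ (∣ U ∣ + 1)) Q.* ((+ 3 Q./ 4) ^ℚ (n ∸ 1 ∸ k / 2 ∸ u))
    ∎
  where
  h = ℓ + u + w + p
  k≡ : k ≡ h * 2
  k≡ = suc-injective (trans (+-comm 1 k) (proj₁ (window-halves ℓ+u≤n W)))
  exponent : n ∸ 1 ∸ k / 2 ∸ u ≡ p
  exponent = trans (cong₂ (λ a t → a ∸ t ∸ u) (cong (_∸ 1) (proj₂ (window-halves ℓ+u≤n W)))
                                               (trans (cong (_/ 2) k≡) (m*n/n≡m h 2)))
                   (∸-∸-cancel h u (m+n∸n≡m (h + (u + p)) 1))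

lemma6 : (n ℓ u : ℕ) → ℓ + u ≤ n → (L : Subset ℓ) → (U : Subset u) → (k : ℕ)
    → n + ℓ ≤ k + 1 → k + 1 ≤ 2 * n ∸ 2 * u
    → (k % 2 ≡ 1 → probMissing n ℓ u L U k ≡ (½ ^ℚ ∣ U ∣) Q.* ((+ 3 Q./ 4) ^ℚ (n ∸ (k + 1) / 2 ∸ u)))
      × (k % 2 ≡ 0 → probMissing n ℓ u L U k ≡ (½ ^ℚ (∣ U ∣ + 1)) Q.* ((+ 3 Q./ 4) ^ℚ (n ∸ 1 ∸ k / 2 ∸ u)))
lemma6 n ℓ u ℓ+u≤n L U k lo hi = probMissing-odd ℓ+u≤n W L U , probMissing-even ℓ+u≤n W L U
  where W = find-window ℓ+u≤n lo hi
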